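{- Let $p$ be a prime and let $R$ be a subset of the residues modulo $p$ with $|R|=s$. Let $L=\{l\in\{0,1,2,\dots\} : l \bmod p \in R\}$. Then for every bipartite graph $G$ (with a fixed bipartition): (i) $\displaystyle \operatorname{bmr}_p(G^c)\leq \sum_{t=0}^{s}\binom{\theta_L(G)}{t}$; (ii) $\displaystyle \operatorname{bmr}_p(G)\leq \sum_{t=0}^{p-1}\binom{\theta_L(G)}{t}$.
   Context: Let $G$ be a bipartite graph with fixed vertex partition $V=V_1\cup V_2$. For a set $L$ of non-negative integers, a bipartite $L$-intersection representation of $G$ assigns to each vertex $v$ a finite set $A_v$ such that for $u\in V_1$, $v\in V_2$, $u$ and $v$ are adjacent if and only if $|A_u\cap A_v|\in L$ (no condition is imposed on pairs inside the same part). The bipartite $L$-intersection number $\theta_L(G)$ is the minimum of $|\bigcup_{v\in V}A_v|$ over all such representations. Here $G^c$ denotes the bipartite complement: the bipartite graph on the same partition $V_1\cup V_2$ in which $u\in V_1$ and $v\in V_2$ are adjacent iff they are not adjacent in $G$. For a matrix $A$ over a field $\mathbb{F}$ with rows indexed by $V_1$ and columns by $V_2$, $\mathcal{G}_b(A)$ is the bipartite graph with parts $V_1,V_2$ and edges $\{ij: A_{ij}\neq 0\}$. The bipartite minimum rank is $\operatorname{bmr}^{\mathbb{F}}(G)=\min\{\operatorname{rank}(A): \mathcal{G}_b(A)=G\}$, and $\operatorname{bmr}_p(G)$ denotes $\operatorname{bmr}^{\mathbb{Z}_p}(G)$. -}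

module Defs where

open import Data.Nat using (ℕ; zero; suc; _+_; _*_; _≤_)
open import Data.Nat.Combinatorics using (_C_)
open import Data.Bool using (Bool; true; not)
open import Data.Fin using (Fin; toℕ)
open import Data.Fin.Subset using (Subset; _∈_; _∩_; _∪_; ⋃; ∣_∣)
open import Data.List using (List; upTo; map; tabulate; _++_)
open import Data.Nat.ListAction using (sum)
open import Data.Integer as ℤ using (ℤ; +_; _-_)
open import Data.Integer.Divisibility using () renaming (_∣_ to _∣ℤ_)
open import Data.Product using (Σ; ∃; _×_; _,_)
open import Relation.Binary.PropositionalEquality using (_≡_)
open import Relation.Nullary using (¬_)
open import Function.Bundles using (_⇔_)

-- Bipartite graphs with fixed bipartition V₁ = Fin m, V₂ = Fin n.
-- G i j ≡ true  means  i ∈ V₁ and j ∈ V₂ are adjacent.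

BipGraph : ℕ → ℕ → Set
BipGraph m n = Fin m → Fin n → Bool

Adj : ∀ {m n} → BipGraph m n → Fin m → Fin n → Set
Adj G i j = G i j ≡ true

_ᶜ : ∀ {m n} → BipGraph m n → BipGraph m n
(G ᶜ) i j = not (G i j)

-- Bipartite L-intersection representations and θ_L(G).
-- A set L ⊆ ℕ is a predicate ℕ → Set.  The finite sets A_v are taken
-- as subsets of a finite ground set Fin N (N arbitrary).

record BipRep (L : ℕ → Set) {m n : ℕ} (G : BipGraph m n) : Set where
  field
    N  : ℕ
    A₁ : Fin m → Subset N
    A₂ : Fin n → Subset N
    rep : ∀ i j → Adj G i j ⇔ L ∣ A₁ i ∩ A₂ j ∣

unionSize : ∀ {L m n} {G : BipGraph m n} → BipRep L G → ℕ
unionSize {m = m} {n} r =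
  ∣ ⋃ (tabulate {n = m} A₁ ++ tabulate {n = n} A₂) ∣
  where open BipRep r

IsBipIntNumber : (L : ℕ → Set) → ∀ {m n} → BipGraph m n → ℕ → Set
IsBipIntNumber L G k =
  Σ (BipRep L G) (λ r → unionSize r ≡ k) ×
  (∀ (r : BipRep L G) → k ≤ unionSize r)

-- Matrices over ℤ_p, represented by integer matrices modulo p.

Matrix : ℕ → ℕ → Set
Matrix m n = Fin m → Fin n → ℤ

_≡_[mod_] : ℤ → ℤ → ℕ → Set
a ≡ b [mod p ] = (+ p) ∣ℤ (a - b)

NonZeroMod : ℕ → ℤ → Set
NonZeroMod p a = ¬ ((+ p) ∣ℤ a)

sumℤ : (r : ℕ) → (Fin r → ℤ) → ℤ
sumℤ zero    f = + 0
sumℤ (suc r) f = f Fin.zero ℤ.+ sumℤ r (λ k → f (Fin.suc k))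
  where import Data.Fin as Fin

FactorsThrough : (p : ℕ) → ∀ {m n} → Matrix m n → ℕ → Set
FactorsThrough p {m} {n} A r =
  Σ (Matrix m r) λ B → Σ (Matrix r n) λ C →
    ∀ i j → A i j ≡ sumℤ r (λ k → B i k ℤ.* C k j) [mod p ]

IsRankMod : (p : ℕ) → ∀ {m n} → Matrix m n → ℕ → Set
IsRankMod p A r = FactorsThrough p A r × (∀ r' → FactorsThrough p A r' → r ≤ r')

HasPattern : (p : ℕ) → ∀ {m n} → Matrix m n → BipGraph m n → Set
HasPattern p A G = ∀ i j → Adj G i j ⇔ NonZeroMod p (A i j)

IsBmr : (p : ℕ) → ∀ {m n} → BipGraph m n → ℕ → Set
IsBmr p {m} {n} G b =
  (Σ (Matrix m n) λ A → HasPattern p A G × IsRankMod p A b) ×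
  (∀ (A : Matrix m n) r → HasPattern p A G → IsRankMod p A r → b ≤ r)

ResidueSet : (p : ℕ) → Subset p → ℕ → Set
ResidueSet p R l = ∃ λ (ρ : Fin p) → ρ ∈ R × ∃ λ q → l ≡ q * p + toℕ ρ

binomSum : ℕ → ℕ → ℕ
binomSum k s = sum (map (λ t → k C t) (upTo (suc s)))

{-# OPTIONS --safe #-}
-- Let F : ℕ → ℤ be a polynomial of degree < d (here: Δᵈ F = 0). For subsets Aᵢ, Bⱼ of a ground
-- set U with |U| = θ, the matrix F(|Aᵢ ∩ Bⱼ|) has rank at most Σ_{t<d} (θ choose t) over ℤ:
-- splitting off one element u of U gives
--   F(|A ∩ B|) = F(|A′ ∩ B′|) + [u ∈ A][u ∈ B] · ΔF(|A′ ∩ B′|),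
-- a sum of a matrix of the same kind and a rescaled one of degree < d − 1, and Pascal's rule
-- closes the induction on U. For (i) take F(l) = ∏_{ρ ∈ R} (l − ρ): it has degree |R| and is
-- nonzero mod p exactly when l ∉ L, so F(|Aᵢ ∩ Bⱼ|) realises the pattern of Gᶜ. For (ii) take the
-- product over the complement of R, of degree p − |R| ≤ p − 1, nonzero mod p exactly when l ∈ L
-- (if R = ∅ then G is empty and F = 0 will do).
module Submission where

open import Defs
open import Data.Nat using (ℕ; zero; suc; _+_; _*_; _∸_; _≤_; _<_; z≤n; s≤s; NonZero; >-nonZero; _≤?_)
import Data.Nat.Properties as ℕ
open import Data.Nat.Combinatorics using (_C_; nCk+nC[k+1]≡[n+1]C[k+1])
open import Data.Nat.Divisibility using (_∣_; divides; _∣0; ∣m⇒∣m*n; ∣n⇒∣m*n; ∣1⇒≡1; ∣⇒≤)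
open import Data.Nat.DivMod using (_%_; _/_; _mod_; _divMod_; DivMod; m≡m%n+[m/n]*n; [m+kn]%n≡m%n; m<n⇒m%n≡m; m%n<n)
open import Data.Nat.ListAction using (sum)
open import Data.Nat.Induction using (<-rec)
open import Data.Nat.Primality using (Prime; euclidsLemma; prime⇒nonZero; ¬prime[1])
open import Data.Integer as ℤ using (ℤ; +_; _-_)
import Data.Integer.Properties as ℤ
open import Data.Integer.Divisibility using () renaming (_∣_ to _∣ℤ_)
open import Data.Integer.Tactic.RingSolver using (solve-∀)
open import Data.Bool using (Bool; true; false; not)
open import Data.Fin as Fin using (Fin; toℕ; _↑ˡ_; _↑ʳ_)
import Data.Fin.Properties as Finₚ
open import Data.Fin.Subset using (Subset; Nonempty; _∈_; _∩_; _⊆_; ⋃; ∁; ∣_∣; inside; outside)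
import Data.Fin.Subset.Properties as Subset
open import Data.Vec using ([]; _∷_; head; tail; here; there)
open import Data.Vec.Functional using (_++_)
open import Data.Vec.Functional.Properties using (lookup-++ˡ; lookup-++ʳ)
open import Data.List using (List; applyUpTo; tabulate)
import Data.List as List
import Data.List.Properties as List
import Data.List.Relation.Unary.Any as Any
open import Data.List.Membership.Propositional using () renaming (_∈_ to _∈ₗ_)
import Data.List.Membership.Propositional.Properties as ∈ₗ
open import Data.Product using (Σ; ∃; _×_; _,_)
open import Data.Sum using (_⊎_; inj₁; inj₂)
open import Data.Empty using (⊥-elim)
open import Relation.Nullary using (¬_; yes; no; contradiction)
open import Relation.Nullary.Decidable using (decidable-stable)
open import Relation.Binary.PropositionalEquality using (_≡_; refl; sym; trans; cong; cong₂; subst; module ≡-Reasoning)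
open import Function.Bundles using (_⇔_; mk⇔; Equivalence)
open import Function.Construct.Composition using (_⇔-∘_)
open import Function.Construct.Symmetry using (⇔-sym)
open import Function.Related.TypeIsomorphisms using (¬-cong-⇔)

open import Algebra.Properties.CommutativeSemigroup ℕ.+-commutativeSemigroup using () renaming (interchange to +-interchange)
open import Algebra.Properties.CommutativeSemigroup ℤ.*-commutativeSemigroup using () renaming (interchange to *-interchange)

open Equivalence using (to; from)

-- Finite differences and polynomials

Δ : (ℕ → ℤ) → ℕ → ℤ
Δ F l = F (suc l) - F l

DegreeBelow : ℕ → (ℕ → ℤ) → Set
DegreeBelow zero    F = ∀ l → F l ≡ + 0
DegreeBelow (suc d) F = DegreeBelow d (Δ F)

DegreeBelow-resp : ∀ d {F G : ℕ → ℤ} → (∀ l → F l ≡ G l) → DegreeBelow d F → DegreeBelow d G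
DegreeBelow-resp zero    F≡G F₀ l = trans (sym (F≡G l)) (F₀ l)
DegreeBelow-resp (suc d) F≡G ΔF   = DegreeBelow-resp d (λ l → cong₂ _-_ (F≡G (suc l)) (F≡G l)) ΔF

DegreeBelow-+ : ∀ d {F G : ℕ → ℤ} → DegreeBelow d F → DegreeBelow d G → DegreeBelow d (λ l → F l ℤ.+ G l)
DegreeBelow-+ zero    F₀ G₀ l rewrite F₀ l | G₀ l = refl
DegreeBelow-+ (suc d) {F} {G} ΔF ΔG =
  DegreeBelow-resp d (λ l → Δ-+ (F (suc l)) (F l) (G (suc l)) (G l)) (DegreeBelow-+ d {Δ F} {Δ G} ΔF ΔG)
  where
  Δ-+ : ∀ a b c e → (a - b) ℤ.+ (c - e) ≡ (a ℤ.+ c) - (b ℤ.+ e)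
  Δ-+ = solve-∀

-- Δ ((· + c) F) = (· + (c + 1)) Δ F + F
DegreeBelow-linear* : ∀ d (c : ℤ) {F : ℕ → ℤ} → DegreeBelow d F → DegreeBelow (suc d) (λ l → (+ l ℤ.+ c) ℤ.* F l)
DegreeBelow-linear* zero c {F} F₀ l = begin
  (+ suc l ℤ.+ c) ℤ.* F (suc l) - (+ l ℤ.+ c) ℤ.* F l   ≡⟨ cong₂ (λ x y → (+ suc l ℤ.+ c) ℤ.* x - (+ l ℤ.+ c) ℤ.* y) (F₀ (suc l)) (F₀ l) ⟩
  (+ suc l ℤ.+ c) ℤ.* + 0 - (+ l ℤ.+ c) ℤ.* + 0         ≡⟨ cong₂ _-_ (ℤ.*-zeroʳ (+ suc l ℤ.+ c)) (ℤ.*-zeroʳ (+ l ℤ.+ c)) ⟩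
  + 0                                                   ∎
  where open ≡-Reasoning
DegreeBelow-linear* (suc d) c {F} ΔF =
  DegreeBelow-resp (suc d) (λ l → sym (Δ-linear* (+ l) c (F (suc l)) (F l)))
    (DegreeBelow-+ (suc d) {λ l → (+ l ℤ.+ (c ℤ.+ + 1)) ℤ.* Δ F l} {F} (DegreeBelow-linear* d (c ℤ.+ + 1) ΔF) ΔF)
  where
  Δ-linear* : ∀ x c a b → ((+ 1 ℤ.+ x) ℤ.+ c) ℤ.* a - (x ℤ.+ c) ℤ.* b ≡ (x ℤ.+ (c ℤ.+ + 1)) ℤ.* (a - b) ℤ.+ b
  Δ-linear* = solve-∀

vanishingPoly : ∀ {k} → (Fin k → ℕ) → Subset k → ℕ → ℤ
vanishingPoly f []             l = + 1
vanishingPoly f (inside  ∷ R) l = (+ l - + f Fin.zero) ℤ.* vanishingPoly (λ ρ → f (Fin.suc ρ)) R l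
vanishingPoly f (outside ∷ R) l = vanishingPoly (λ ρ → f (Fin.suc ρ)) R l

DegreeBelow-vanishingPoly : ∀ {k} (f : Fin k → ℕ) (R : Subset k) → DegreeBelow (suc ∣ R ∣) (vanishingPoly f R)
DegreeBelow-vanishingPoly f []            = λ l → refl
DegreeBelow-vanishingPoly f (inside  ∷ R) =
  DegreeBelow-linear* (suc ∣ R ∣) (ℤ.- + f Fin.zero) (DegreeBelow-vanishingPoly (λ ρ → f (Fin.suc ρ)) R)
DegreeBelow-vanishingPoly f (outside ∷ R) = DegreeBelow-vanishingPoly (λ ρ → f (Fin.suc ρ)) R

-- Divisibility by a prime and residues

module _ {p : ℕ} (p-prime : Prime p) where

  private instance
    p≢0 : NonZero p
    p≢0 = prime⇒nonZero p-prime

  p∤1 : ¬ (+ p) ∣ℤ (+ 1)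
  p∤1 p∣1 = ¬prime[1] (subst Prime (∣1⇒≡1 p∣1) p-prime)

  ∣ℤ-*ʳ : ∀ x y → (+ p) ∣ℤ x → (+ p) ∣ℤ (x ℤ.* y)
  ∣ℤ-*ʳ x y p∣x = subst (p ∣_) (sym (ℤ.abs-* x y)) (∣m⇒∣m*n ℤ.∣ y ∣ p∣x)

  ∣ℤ-*ˡ : ∀ x y → (+ p) ∣ℤ y → (+ p) ∣ℤ (x ℤ.* y)
  ∣ℤ-*ˡ x y p∣y = subst (p ∣_) (sym (ℤ.abs-* x y)) (∣n⇒∣m*n ℤ.∣ x ∣ p∣y)

  euclidsLemmaℤ : ∀ x y → (+ p) ∣ℤ (x ℤ.* y) → (+ p) ∣ℤ x ⊎ (+ p) ∣ℤ y
  euclidsLemmaℤ x y p∣xy = euclidsLemma ℤ.∣ x ∣ ℤ.∣ y ∣ p-prime (subst (p ∣_) (ℤ.abs-* x y) p∣xy)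

  ∣vanishingPoly⇒ : ∀ {k} (f : Fin k → ℕ) (R : Subset k) l →
    (+ p) ∣ℤ vanishingPoly f R l → ∃ λ ρ → ρ ∈ R × (+ p) ∣ℤ (+ l - + f ρ)
  ∣vanishingPoly⇒ f []            l p∣1 = ⊥-elim (p∤1 p∣1)
  ∣vanishingPoly⇒ f (inside  ∷ R) l p∣ with euclidsLemmaℤ (+ l - + f Fin.zero) _ p∣
  ... | inj₁ p∣first = Fin.zero , here , p∣first
  ... | inj₂ p∣rest  with ρ , ρ∈R , p∣l-ρ ← ∣vanishingPoly⇒ (λ ρ → f (Fin.suc ρ)) R l p∣rest =
    Fin.suc ρ , there ρ∈R , p∣l-ρ
  ∣vanishingPoly⇒ f (outside ∷ R) l p∣ with ρ , ρ∈R , p∣l-ρ ← ∣vanishingPoly⇒ (λ ρ → f (Fin.suc ρ)) R l p∣ =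
    Fin.suc ρ , there ρ∈R , p∣l-ρ

  ∣vanishingPoly⇐ : ∀ {k} (f : Fin k → ℕ) {R : Subset k} {ρ} l →
    ρ ∈ R → (+ p) ∣ℤ (+ l - + f ρ) → (+ p) ∣ℤ vanishingPoly f R l
  ∣vanishingPoly⇐ f {inside  ∷ R} l here        p∣l-ρ =
    ∣ℤ-*ʳ (+ l - + f Fin.zero) (vanishingPoly (λ ρ → f (Fin.suc ρ)) R l) p∣l-ρ
  ∣vanishingPoly⇐ f {inside  ∷ R} l (there ρ∈R) p∣l-ρ =
    ∣ℤ-*ˡ (+ l - + f Fin.zero) (vanishingPoly (λ ρ → f (Fin.suc ρ)) R l) (∣vanishingPoly⇐ (λ ρ → f (Fin.suc ρ)) l ρ∈R p∣l-ρ)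
  ∣vanishingPoly⇐ f {outside ∷ R} l (there ρ∈R) p∣l-ρ = ∣vanishingPoly⇐ (λ ρ → f (Fin.suc ρ)) l ρ∈R p∣l-ρ

  [q*p+r]%p≡r : ∀ q {r} → r < p → (q * p + r) % p ≡ r
  [q*p+r]%p≡r q {r} r<p = begin
    (q * p + r) % p ≡⟨ cong (_% p) (ℕ.+-comm (q * p) r) ⟩
    (r + q * p) % p ≡⟨ [m+kn]%n≡m%n r q p ⟩
    r % p           ≡⟨ m<n⇒m%n≡m r<p ⟩
    r               ∎
    where open ≡-Reasoning

  ∣ℤ[+l-+r]⇔%≡ : ∀ l {r} → r < p → (+ p) ∣ℤ (+ l - + r) ⇔ l % p ≡ r
  ∣ℤ[+l-+r]⇔%≡ l {r} r<p = mk⇔ ⇒ ⇐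
    where
    ⇒ : (+ p) ∣ℤ (+ l - + r) → l % p ≡ r
    ⇒ p∣ with r ≤? l
    ... | yes r≤l with divides q l∸r≡q*p ← subst (p ∣_) (cong ℤ.∣_∣ (trans (ℤ.[+m]-[+n]≡m⊖n l r) (ℤ.⊖-≥ r≤l))) p∣ =
      trans (cong (_% p) (trans (sym (ℕ.m∸n+n≡m r≤l)) (cong (_+ r) l∸r≡q*p))) ([q*p+r]%p≡r q r<p)
    ... | no r≰l = contradiction (ℕ.<-≤-trans r<p (ℕ.≤-trans p≤r∸l (ℕ.m∸n≤m r l))) (ℕ.<-irrefl refl)
      where
      l<r = ℕ.≰⇒> r≰l
      instance
        r∸l≢0 : NonZero (r ∸ l)
        r∸l≢0 = >-nonZero (ℕ.m<n⇒0<n∸m l<r)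
      p≤r∸l : p ≤ r ∸ l
      p≤r∸l = ∣⇒≤ (subst (p ∣_) (trans (cong ℤ.∣_∣ (ℤ.[+m]-[+n]≡m⊖n l r)) (ℤ.∣⊖∣-< l<r)) p∣)
    ⇐ : l % p ≡ r → (+ p) ∣ℤ (+ l - + r)
    ⇐ l%p≡r = subst (λ x → p ∣ ℤ.∣ + x - + r ∣) (sym l≡r+k) (divides (l / p) (∣+[r+k]-+r∣≡k (l / p * p)))
      where
      l≡r+k : l ≡ r + l / p * p
      l≡r+k = trans (m≡m%n+[m/n]*n l p) (cong (_+ l / p * p) l%p≡r)
      ∣+[r+k]-+r∣≡k : ∀ k → ℤ.∣ + (r + k) - + r ∣ ≡ k
      ∣+[r+k]-+r∣≡k k = trans (cong ℤ.∣_∣ (trans (ℤ.[+m]-[+n]≡m⊖n (r + k) r) (ℤ.⊖-≥ (ℕ.m≤m+n r k)))) (ℕ.m+n∸m≡n r k)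

  mod≡⇔%≡ : ∀ l {ρ : Fin p} → l mod p ≡ ρ ⇔ l % p ≡ toℕ ρ
  mod≡⇔%≡ l = mk⇔ (λ l-mod-p≡ρ → trans (sym (Finₚ.toℕ-fromℕ< (m%n<n l p))) (cong toℕ l-mod-p≡ρ))
                  (λ l%p≡ρ → Finₚ.toℕ-injective (trans (Finₚ.toℕ-fromℕ< (m%n<n l p)) l%p≡ρ))

  ResidueSet⇔mod∈ : ∀ (R : Subset p) l → ResidueSet p R l ⇔ l mod p ∈ R
  ResidueSet⇔mod∈ R l = mk⇔ ⇒ ⇐
    where
    ⇒ : ResidueSet p R l → l mod p ∈ R
    ⇒ (ρ , ρ∈R , q , l≡q*p+ρ) =
      subst (_∈ R) (sym (from (mod≡⇔%≡ l) (trans (cong (_% p) l≡q*p+ρ) ([q*p+r]%p≡r q (Finₚ.toℕ<n ρ))))) ρ∈R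
    ⇐ : l mod p ∈ R → ResidueSet p R l
    ⇐ l-mod-p∈R = l mod p , l-mod-p∈R , l / p , trans (DivMod.property (l divMod p)) (ℕ.+-comm _ (l / p * p))

  ∣vanishingPoly⇔mod∈ : ∀ (R : Subset p) l → (+ p) ∣ℤ vanishingPoly toℕ R l ⇔ l mod p ∈ R
  ∣vanishingPoly⇔mod∈ R l = mk⇔ ⇒ ⇐
    where
    ∣ℤ[+l-ρ]⇔mod≡ : ∀ ρ → (+ p) ∣ℤ (+ l - + toℕ ρ) ⇔ l mod p ≡ ρ
    ∣ℤ[+l-ρ]⇔mod≡ ρ = ⇔-sym (mod≡⇔%≡ l) ⇔-∘ ∣ℤ[+l-+r]⇔%≡ l (Finₚ.toℕ<n ρ)
    ⇒ : (+ p) ∣ℤ vanishingPoly toℕ R l → l mod p ∈ R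
    ⇒ p∣ with ρ , ρ∈R , p∣l-ρ ← ∣vanishingPoly⇒ toℕ R l p∣ = subst (_∈ R) (sym (to (∣ℤ[+l-ρ]⇔mod≡ ρ) p∣l-ρ)) ρ∈R
    ⇐ : l mod p ∈ R → (+ p) ∣ℤ vanishingPoly toℕ R l
    ⇐ l-mod-p∈R = ∣vanishingPoly⇐ toℕ l l-mod-p∈R (from (∣ℤ[+l-ρ]⇔mod≡ (l mod p)) refl)

  ¬ResidueSet⇔vanishingPoly≢0 : ∀ (R : Subset p) l → (¬ ResidueSet p R l) ⇔ NonZeroMod p (vanishingPoly toℕ R l)
  ¬ResidueSet⇔vanishingPoly≢0 R l = ¬-cong-⇔ (⇔-sym (∣vanishingPoly⇔mod∈ R l) ⇔-∘ ResidueSet⇔mod∈ R l)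

  ResidueSet⇔vanishingPoly∁≢0 : ∀ (R : Subset p) l → ResidueSet p R l ⇔ NonZeroMod p (vanishingPoly toℕ (∁ R) l)
  ResidueSet⇔vanishingPoly∁≢0 R l =
    ¬-cong-⇔ (⇔-sym (∣vanishingPoly⇔mod∈ (∁ R) l))
      ⇔-∘ (mk⇔ Subset.x∈p⇒x∉∁p Subset.x∉∁p⇒x∈p ⇔-∘ ResidueSet⇔mod∈ R l)

  ¬Nonempty⇒ResidueSet⇔0≢0 : ∀ {R : Subset p} → ¬ Nonempty R → ∀ l → ResidueSet p R l ⇔ NonZeroMod p (+ 0)
  ¬Nonempty⇒ResidueSet⇔0≢0 R-empty l =
    mk⇔ (λ (ρ , ρ∈R , _) → contradiction (ρ , ρ∈R) R-empty) (λ 0≢0 → contradiction (p ∣0) 0≢0)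

-- Binomial sums

binomSumBelow : ℕ → ℕ → ℕ
binomSumBelow k d = sum (applyUpTo (k C_) d)

binomSum≡binomSumBelow : ∀ k s → binomSum k s ≡ binomSumBelow k (suc s)
binomSum≡binomSumBelow k s = cong sum (List.map-upTo (k C_) (suc s))

sum-applyUpTo-+ : ∀ (f g : ℕ → ℕ) d →
  sum (applyUpTo (λ t → f t + g t) d) ≡ sum (applyUpTo f d) + sum (applyUpTo g d)
sum-applyUpTo-+ f g zero    = refl
sum-applyUpTo-+ f g (suc d) = begin
  (f 0 + g 0) + sum (applyUpTo (λ t → f (suc t) + g (suc t)) d)  ≡⟨ cong (λ x → (f 0 + g 0) + x) (sum-applyUpTo-+ (λ t → f (suc t)) (λ t → g (suc t)) d) ⟩
  (f 0 + g 0) + (Σf + Σg)                                          ≡⟨ +-interchange (f 0) (g 0) Σf Σg ⟩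
  (f 0 + Σf) + (g 0 + Σg)                                          ∎
  where
  open ≡-Reasoning
  Σf = sum (applyUpTo (λ t → f (suc t)) d)
  Σg = sum (applyUpTo (λ t → g (suc t)) d)

sum-applyUpTo-cong : ∀ {f g : ℕ → ℕ} d → (∀ t → f t ≡ g t) → sum (applyUpTo f d) ≡ sum (applyUpTo g d)
sum-applyUpTo-cong zero    f≡g = refl
sum-applyUpTo-cong (suc d) f≡g = cong₂ _+_ (f≡g 0) (sum-applyUpTo-cong d (λ t → f≡g (suc t)))

sum-applyUpTo-mono : ∀ (f : ℕ → ℕ) {d d′} → d ≤ d′ → sum (applyUpTo f d) ≤ sum (applyUpTo f d′)
sum-applyUpTo-mono f z≤n       = z≤n
sum-applyUpTo-mono f (s≤s d≤d′) = ℕ.+-monoʳ-≤ (f 0) (sum-applyUpTo-mono (λ t → f (suc t)) d≤d′)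

binomSumBelow-pascal : ∀ k d → binomSumBelow (suc k) (suc d) ≡ binomSumBelow k (suc d) + binomSumBelow k d
binomSumBelow-pascal k d = begin
  1 + sum (applyUpTo (λ t → suc k C suc t) d)                   ≡⟨ cong (λ x → 1 + x) (sum-applyUpTo-cong d (λ t → sym (nCk+nC[k+1]≡[n+1]C[k+1] k t))) ⟩
  1 + sum (applyUpTo (λ t → k C t + k C suc t) d)               ≡⟨ cong (λ x → 1 + x) (sum-applyUpTo-+ (k C_) (λ t → k C suc t) d) ⟩
  1 + (binomSumBelow k d + Σ′)                                   ≡⟨ cong (λ x → 1 + x) (ℕ.+-comm (binomSumBelow k d) Σ′) ⟩
  (1 + Σ′) + binomSumBelow k d                                   ∎
  where
  open ≡-Reasoning
  Σ′ = sum (applyUpTo (λ t → k C suc t) d)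

-- Factorisations over ℤ and the bipartite minimum rank

sumℤ-cong : ∀ r {f g : Fin r → ℤ} → (∀ k → f k ≡ g k) → sumℤ r f ≡ sumℤ r g
sumℤ-cong zero    f≡g = refl
sumℤ-cong (suc r) f≡g = cong₂ ℤ._+_ (f≡g Fin.zero) (sumℤ-cong r (λ k → f≡g (Fin.suc k)))

sumℤ-zero : ∀ r → sumℤ r (λ _ → + 0) ≡ + 0
sumℤ-zero zero    = refl
sumℤ-zero (suc r) = trans (ℤ.+-identityˡ _) (sumℤ-zero r)

sumℤ-*ˡ : ∀ r c (f : Fin r → ℤ) → sumℤ r (λ k → c ℤ.* f k) ≡ c ℤ.* sumℤ r f
sumℤ-*ˡ zero    c f = sym (ℤ.*-zeroʳ c)
sumℤ-*ˡ (suc r) c f = trans (cong (λ x → c ℤ.* f Fin.zero ℤ.+ x) (sumℤ-*ˡ r c (λ k → f (Fin.suc k))))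
                            (sym (ℤ.*-distribˡ-+ c _ _))

sumℤ-++ : ∀ r₁ {r₂} (f : Fin (r₁ + r₂) → ℤ) →
  sumℤ (r₁ + r₂) f ≡ sumℤ r₁ (λ k → f (k ↑ˡ r₂)) ℤ.+ sumℤ r₂ (λ k → f (r₁ ↑ʳ k))
sumℤ-++ zero    f = sym (ℤ.+-identityˡ _)
sumℤ-++ (suc r₁) f = trans (cong (λ x → f Fin.zero ℤ.+ x) (sumℤ-++ r₁ (λ k → f (Fin.suc k))))
                           (sym (ℤ.+-assoc (f Fin.zero) _ _))

Factorsℤ : ∀ {m n} → Matrix m n → ℕ → Set
Factorsℤ {m} {n} M r = Σ (Matrix m r) λ B → Σ (Matrix r n) λ C →
  ∀ i j → M i j ≡ sumℤ r (λ k → B i k ℤ.* C k j)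

module _ {m n : ℕ} where

  Factorsℤ-resp : ∀ {M M′ : Matrix m n} {r} → (∀ i j → M i j ≡ M′ i j) → Factorsℤ M r → Factorsℤ M′ r
  Factorsℤ-resp M≡M′ (B , C , M≡BC) = B , C , λ i j → trans (sym (M≡M′ i j)) (M≡BC i j)

  Factorsℤ-zero : ∀ r → Factorsℤ {m} {n} (λ _ _ → + 0) r
  Factorsℤ-zero r = (λ _ _ → + 0) , (λ _ _ → + 0) , λ i j → sym (sumℤ-zero r)

  Factorsℤ-const : ∀ c → Factorsℤ {m} {n} (λ _ _ → c) 1
  Factorsℤ-const c = (λ _ _ → c) , (λ _ _ → + 1) , λ i j → sym (trans (ℤ.+-identityʳ _) (ℤ.*-identityʳ c))

  Factorsℤ-+ : ∀ {M M′ : Matrix m n} {r₁ r₂} → Factorsℤ M r₁ → Factorsℤ M′ r₂ →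
    Factorsℤ (λ i j → M i j ℤ.+ M′ i j) (r₁ + r₂)
  Factorsℤ-+ {M} {M′} {r₁} {r₂} (B₁ , C₁ , M≡B₁C₁) (B₂ , C₂ , M′≡B₂C₂) = B , C , M+M′≡BC
    where
    B : Matrix m (r₁ + r₂)
    B i = B₁ i ++ B₂ i
    C : Matrix (r₁ + r₂) n
    C k j = ((λ k → C₁ k j) ++ (λ k → C₂ k j)) k
    M+M′≡BC : ∀ i j → M i j ℤ.+ M′ i j ≡ sumℤ (r₁ + r₂) (λ k → B i k ℤ.* C k j)
    M+M′≡BC i j = sym (begin
      sumℤ (r₁ + r₂) (λ k → B i k ℤ.* C k j)
        ≡⟨ sumℤ-++ r₁ (λ k → B i k ℤ.* C k j) ⟩
      sumℤ r₁ (λ k → B i (k ↑ˡ r₂) ℤ.* C (k ↑ˡ r₂) j) ℤ.+ sumℤ r₂ (λ k → B i (r₁ ↑ʳ k) ℤ.* C (r₁ ↑ʳ k) j)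
        ≡⟨ cong₂ ℤ._+_ (sumℤ-cong r₁ (λ k → cong₂ ℤ._*_ (lookup-++ˡ (B₁ i) (B₂ i) k) (lookup-++ˡ _ (λ k → C₂ k j) k)))
                       (sumℤ-cong r₂ (λ k → cong₂ ℤ._*_ (lookup-++ʳ (B₁ i) (B₂ i) k) (lookup-++ʳ (λ k → C₁ k j) _ k))) ⟩
      sumℤ r₁ (λ k → B₁ i k ℤ.* C₁ k j) ℤ.+ sumℤ r₂ (λ k → B₂ i k ℤ.* C₂ k j)
        ≡⟨ cong₂ ℤ._+_ (M≡B₁C₁ i j) (M′≡B₂C₂ i j) ⟨
      M i j ℤ.+ M′ i j ∎)
      where open ≡-Reasoning

  Factorsℤ-scale : ∀ {M : Matrix m n} {r} (x : Fin m → ℤ) (y : Fin n → ℤ) →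
    Factorsℤ M r → Factorsℤ (λ i j → (x i ℤ.* y j) ℤ.* M i j) r
  Factorsℤ-scale {M} {r} x y (B , C , M≡BC) = (λ i k → x i ℤ.* B i k) , (λ k j → y j ℤ.* C k j) , xyM≡BC
    where
    xyM≡BC : ∀ i j → (x i ℤ.* y j) ℤ.* M i j ≡ sumℤ r (λ k → (x i ℤ.* B i k) ℤ.* (y j ℤ.* C k j))
    xyM≡BC i j = sym (begin
      sumℤ r (λ k → (x i ℤ.* B i k) ℤ.* (y j ℤ.* C k j)) ≡⟨ sumℤ-cong r (λ k → *-interchange (x i) (B i k) (y j) (C k j)) ⟩
      sumℤ r (λ k → (x i ℤ.* y j) ℤ.* (B i k ℤ.* C k j)) ≡⟨ sumℤ-*ˡ r (x i ℤ.* y j) _ ⟩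
      (x i ℤ.* y j) ℤ.* sumℤ r (λ k → B i k ℤ.* C k j)   ≡⟨ cong (λ z → (x i ℤ.* y j) ℤ.* z) (M≡BC i j) ⟨
      (x i ℤ.* y j) ℤ.* M i j                             ∎)
      where open ≡-Reasoning

  Factorsℤ-mono : ∀ {M : Matrix m n} {r r′} → r ≤ r′ → Factorsℤ M r → Factorsℤ M r′
  Factorsℤ-mono {M} {r} r≤r′ M-r = subst (Factorsℤ M) (ℕ.m+[n∸m]≡n r≤r′)
    (Factorsℤ-resp (λ i j → ℤ.+-identityʳ (M i j)) (Factorsℤ-+ M-r (Factorsℤ-zero _)))

  Factorsℤ⇒FactorsThrough : ∀ p {M : Matrix m n} {r} → Factorsℤ M r → FactorsThrough p M r
  Factorsℤ⇒FactorsThrough p {r = r} (B , C , M≡BC) = B , C , λ i j →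
    subst (λ x → p ∣ ℤ.∣ x - sumℤ r (λ k → B i k ℤ.* C k j) ∣) (sym (M≡BC i j))
          (subst (λ x → p ∣ ℤ.∣ x ∣) (sym (ℤ.+-inverseʳ (sumℤ r (λ k → B i k ℤ.* C k j)))) (p ∣0))

-- FactorsThrough p M is undecidable, so its least inhabitant (the rank of M) exists only under ¬¬;
-- this suffices because the goal b ≤ K is decidable.
¬¬-least : (P : ℕ → Set) → ∀ k → P k → ¬ ¬ (∃ λ r → P r × (∀ r′ → P r′ → r ≤ r′))
¬¬-least P = <-rec _ λ k IH Pk ¬minimal →
  ¬minimal (k , Pk , λ r′ Pr′ → ℕ.≮⇒≥ (λ r′<k → IH r′<k Pr′ ¬minimal))

IsBmr-≤-Factorsℤ : ∀ p {m n} {H : BipGraph m n} {M : Matrix m n} {K b} →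
  HasPattern p M H → Factorsℤ M K → IsBmr p H b → b ≤ K
IsBmr-≤-Factorsℤ p {M = M} {K} {b} M∼H M-K (_ , b-minimal) =
  decidable-stable (b ≤? K) λ b≰K →
    ¬¬-least (FactorsThrough p M) K (Factorsℤ⇒FactorsThrough p M-K) λ (r , M-r , r-minimal) →
      b≰K (ℕ.≤-trans (b-minimal M r M∼H (M-r , r-minimal)) (r-minimal K (Factorsℤ⇒FactorsThrough p M-K)))

-- Intersection matrices

χ : Bool → ℤ
χ true  = + 1
χ false = + 0

x≡x+0*y : ∀ x y → x ≡ x ℤ.+ + 0 ℤ.* y
x≡x+0*y x y = sym (trans (cong (λ z → x ℤ.+ z) (ℤ.*-zeroˡ y)) (ℤ.+-identityʳ x))

F∣∩∣-expand-head : ∀ {N} (F : ℕ → ℤ) (a b : Subset (suc N)) →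
  F (∣ a ∩ b ∣) ≡ F (∣ tail a ∩ tail b ∣) ℤ.+ (χ (head a) ℤ.* χ (head b)) ℤ.* Δ F (∣ tail a ∩ tail b ∣)
F∣∩∣-expand-head F (inside  ∷ a) (inside  ∷ b) = new-element (F (suc ∣ a ∩ b ∣)) (F (∣ a ∩ b ∣))
  where
  new-element : ∀ x y → x ≡ y ℤ.+ + 1 ℤ.* (x - y)
  new-element = solve-∀
F∣∩∣-expand-head F (inside  ∷ a) (outside ∷ b) = x≡x+0*y (F (∣ a ∩ b ∣)) (Δ F (∣ a ∩ b ∣))
F∣∩∣-expand-head F (outside ∷ a) (inside  ∷ b) = x≡x+0*y (F (∣ a ∩ b ∣)) (Δ F (∣ a ∩ b ∣))
F∣∩∣-expand-head F (outside ∷ a) (outside ∷ b) = x≡x+0*y (F (∣ a ∩ b ∣)) (Δ F (∣ a ∩ b ∣))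

∣∩∣-empty : (a b : Subset 0) → ∣ a ∩ b ∣ ≡ 0
∣∩∣-empty [] [] = refl

∣∩∣-outside : ∀ {N} (a b : Subset (suc N)) → head a ≡ outside → ∣ a ∩ b ∣ ≡ ∣ tail a ∩ tail b ∣
∣∩∣-outside (outside ∷ a) (_ ∷ b) refl = refl

head-⊆-outside : ∀ {N} {a : Subset (suc N)} {U} → a ⊆ outside ∷ U → head a ≡ outside
head-⊆-outside {a = outside ∷ _} _   = refl
head-⊆-outside {a = inside  ∷ _} a⊆U with () ← a⊆U here

tail-⊆ : ∀ {N} {a : Subset (suc N)} {u U} → a ⊆ u ∷ U → tail a ⊆ U
tail-⊆ {a = _ ∷ _} = Subset.drop-∷-⊆

Factorsℤ-intersectionMatrix : ∀ {N} (U : Subset N) {m n} (a : Fin m → Subset N) (b : Fin n → Subset N) →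
  (∀ i → a i ⊆ U) → (∀ j → b j ⊆ U) → ∀ d (F : ℕ → ℤ) → DegreeBelow d F →
  Factorsℤ (λ i j → F (∣ a i ∩ b j ∣)) (binomSumBelow ∣ U ∣ d)
Factorsℤ-intersectionMatrix U a b a⊆U b⊆U zero F F₀ =
  Factorsℤ-resp (λ i j → sym (F₀ _)) (Factorsℤ-zero 0)
Factorsℤ-intersectionMatrix [] a b a⊆U b⊆U (suc d) F ΔF =
  Factorsℤ-mono (s≤s z≤n) (Factorsℤ-resp (λ i j → cong F (sym (∣∩∣-empty (a i) (b j)))) (Factorsℤ-const (F 0)))
Factorsℤ-intersectionMatrix (outside ∷ U) a b a⊆U b⊆U (suc d) F ΔF =
  Factorsℤ-resp (λ i j → cong F (sym (∣∩∣-outside (a i) (b j) (head-⊆-outside (a⊆U i)))))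
    (Factorsℤ-intersectionMatrix U (λ i → tail (a i)) (λ j → tail (b j))
      (λ i → tail-⊆ (a⊆U i)) (λ j → tail-⊆ (b⊆U j)) (suc d) F ΔF)
Factorsℤ-intersectionMatrix (inside ∷ U) a b a⊆U b⊆U (suc d) F ΔF =
  subst (Factorsℤ _) (sym (binomSumBelow-pascal ∣ U ∣ d))
    (Factorsℤ-resp (λ i j → sym (F∣∩∣-expand-head F (a i) (b j)))
      (Factorsℤ-+ (restrict (suc d) F ΔF) (Factorsℤ-scale (λ i → χ (head (a i))) (λ j → χ (head (b j))) (restrict d (Δ F) ΔF))))
  where
  restrict : ∀ d F → DegreeBelow d F → Factorsℤ (λ i j → F (∣ tail (a i) ∩ tail (b j) ∣)) (binomSumBelow ∣ U ∣ d)
  restrict = Factorsℤ-intersectionMatrix U (λ i → tail (a i)) (λ j → tail (b j)) (λ i → tail-⊆ (a⊆U i)) (λ j → tail-⊆ (b⊆U j))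

⊆-⋃ : ∀ {N} (xs : List (Subset N)) {a} → a ∈ₗ xs → a ⊆ ⋃ xs
⊆-⋃ (x List.∷ xs) (Any.here refl)  = Subset.p⊆p∪q (⋃ xs)
⊆-⋃ (x List.∷ xs) (Any.there a∈xs) = λ y∈a → Subset.q⊆p∪q x (⋃ xs) (⊆-⋃ xs a∈xs y∈a)

intersectionMatrix : ∀ {L m n} {G : BipGraph m n} → BipRep L G → (ℕ → ℤ) → Matrix m n
intersectionMatrix r F i j = F (∣ BipRep.A₁ r i ∩ BipRep.A₂ r j ∣)

IsBmr-≤-binomSumBelow : ∀ p {L m n} {G H : BipGraph m n} {θ} → IsBipIntNumber L G θ →
  ∀ d (F : ℕ → ℤ) → DegreeBelow d F → (∀ (r : BipRep L G) → HasPattern p (intersectionMatrix r F) H) →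
  ∀ b → IsBmr p H b → b ≤ binomSumBelow θ d
IsBmr-≤-binomSumBelow p {m = m} {n} ((r , ∣⋃r∣≡θ) , _) d F F-deg F∼H b b-bmr =
  subst (λ k → b ≤ binomSumBelow k d) ∣⋃r∣≡θ
    (IsBmr-≤-Factorsℤ p (F∼H r)
      (Factorsℤ-intersectionMatrix (⋃ sets) A₁ A₂ A₁⊆⋃ A₂⊆⋃ d F F-deg) b-bmr)
  where
  open BipRep r
  sets = tabulate {n = m} A₁ List.++ tabulate {n = n} A₂
  A₁⊆⋃ : ∀ i → A₁ i ⊆ ⋃ sets
  A₁⊆⋃ i = ⊆-⋃ sets (∈ₗ.∈-++⁺ˡ (∈ₗ.∈-tabulate⁺ i))
  A₂⊆⋃ : ∀ j → A₂ j ⊆ ⋃ sets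
  A₂⊆⋃ j = ⊆-⋃ sets (∈ₗ.∈-++⁺ʳ (tabulate A₁) (∈ₗ.∈-tabulate⁺ j))

not≡true⇔≢true : ∀ x → not x ≡ true ⇔ (¬ x ≡ true)
not≡true⇔≢true true  = mk⇔ (λ ()) (λ true≢true → contradiction refl true≢true)
not≡true⇔≢true false = mk⇔ (λ _ ()) (λ _ → refl)

module _ {p : ℕ} {L : ℕ → Set} {m n : ℕ} {G : BipGraph m n} (r : BipRep L G) (F : ℕ → ℤ) where
  open BipRep r

  HasPattern-intersectionMatrix : (∀ l → L l ⇔ NonZeroMod p (F l)) → HasPattern p (intersectionMatrix r F) G
  HasPattern-intersectionMatrix L⇔F≢0 i j = L⇔F≢0 _ ⇔-∘ rep i j

  HasPattern-intersectionMatrixᶜ : (∀ l → (¬ L l) ⇔ NonZeroMod p (F l)) → HasPattern p (intersectionMatrix r F) (G ᶜ)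
  HasPattern-intersectionMatrixᶜ ¬L⇔F≢0 i j = ¬L⇔F≢0 _ ⇔-∘ (¬-cong-⇔ (rep i j) ⇔-∘ not≡true⇔≢true (G i j))

Nonempty⇒∣∁p∣≤n∸1 : ∀ {k} {R : Subset k} → Nonempty R → ∣ ∁ R ∣ ≤ k ∸ 1
Nonempty⇒∣∁p∣≤n∸1 {k} {R} (_ , x∈R) = subst (_≤ k ∸ 1) (sym (Subset.∣∁p∣≡n∸∣p∣ R))
  (ℕ.∸-monoʳ-≤ k (ℕ.<-≤-trans (s≤s z≤n) (Subset.x∈p⇒∣p-x∣<∣p∣ x∈R)))

theorem4p1 : (p : ℕ) → Prime p → (R : Subset p) →
    ∀ {m n} (G : BipGraph m n) (θ : ℕ) →
    IsBipIntNumber (ResidueSet p R) G θ →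
    (∀ b → IsBmr p (G ᶜ) b → b ≤ binomSum θ ∣ R ∣) ×
    (∀ b → IsBmr p G b → b ≤ binomSum θ (p ∸ 1))
theorem4p1 p p-prime R G θ θ-G = bmr-Gᶜ , bmr-G
  where
  bmr-Gᶜ : ∀ b → IsBmr p (G ᶜ) b → b ≤ binomSum θ ∣ R ∣
  bmr-Gᶜ b b-bmr rewrite binomSum≡binomSumBelow θ ∣ R ∣ =
    IsBmr-≤-binomSumBelow p θ-G (suc ∣ R ∣) (vanishingPoly toℕ R) (DegreeBelow-vanishingPoly toℕ R)
      (λ r → HasPattern-intersectionMatrixᶜ r (vanishingPoly toℕ R) (¬ResidueSet⇔vanishingPoly≢0 p-prime R)) b b-bmr

  bmr-G : ∀ b → IsBmr p G b → b ≤ binomSum θ (p ∸ 1)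
  bmr-G b b-bmr with Subset.nonempty? R
  ... | no R-empty = ℕ.≤-trans
    (IsBmr-≤-binomSumBelow p θ-G 0 (λ _ → + 0) (λ _ → refl)
      (λ r → HasPattern-intersectionMatrix r (λ _ → + 0) (¬Nonempty⇒ResidueSet⇔0≢0 p-prime R-empty)) b b-bmr) z≤n
  ... | yes R-nonempty rewrite binomSum≡binomSumBelow θ (p ∸ 1) = ℕ.≤-trans
    (IsBmr-≤-binomSumBelow p θ-G (suc ∣ ∁ R ∣) (vanishingPoly toℕ (∁ R)) (DegreeBelow-vanishingPoly toℕ (∁ R))
      (λ r → HasPattern-intersectionMatrix r (vanishingPoly toℕ (∁ R)) (ResidueSet⇔vanishingPoly∁≢0 p-prime R)) b b-bmr)
    (sum-applyUpTo-mono (θ C_) (s≤s (Nonempty⇒∣∁p∣≤n∸1 R-nonempty)))
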